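{- For every integer $n\ge 0$, there is exactly one Dumont permutation of the second kind of length $2n$ avoiding the pattern $312$, i.e. $|\mathfrak D^2_{2n}(312)|=1$.
   Context: A permutation $\sigma\in\mathfrak S_m$ contains a pattern $\tau\in\mathfrak S_k$ if $\sigma$ has a subsequence $(\sigma(i_1),\dots,\sigma(i_k))$, $i_1<\dots<i_k$, order-isomorphic to $\tau$; otherwise $\sigma$ avoids $\tau$. A Dumont permutation of the second kind of length $2n$ is a permutation $\pi\in\mathfrak S_{2n}$ with $\pi(2i)<2i$ and $\pi(2i-1)\ge 2i-1$ for all $1\le i\le n$ (entries at even positions are deficiencies, entries at odd positions are fixed points or excedances). For $n=0$ the empty permutation is the unique such permutation. $\mathfrak D^2_{2n}(\tau)$ denotes the set of such permutations avoiding $\tau$. -}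

module Defs where

open import Data.Nat using (ℕ; _+_; _*_; _<_; _≤_)
open import Data.Nat.Properties using ()
open import Data.Fin using (Fin; toℕ)
open import Data.Fin.Permutation using (Permutation′; _⟨$⟩ʳ_)
open import Data.Product using (Σ; ∃; _×_; _,_)
open import Relation.Binary.PropositionalEquality using (_≡_)
open import Relation.Nullary using (¬_)

-- Positions and values are 0-indexed Fin elements; the 1-based position of
-- i is toℕ i + 1 and the 1-based value of π(i) is toℕ (π i) + 1.

data Even : ℕ → Set where
  even-zero : Even 0
  even-ss   : ∀ {n} → Even n → Even (n + 2)

IsDumont2 : (n : ℕ) → Permutation′ (2 * n) → Set
IsDumont2 n π =
  ∀ (i : Fin (2 * n)) →
    (¬ Even (toℕ i + 1) → toℕ i ≤ toℕ (π ⟨$⟩ʳ i)) ×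
    (Even (toℕ i + 1) → toℕ (π ⟨$⟩ʳ i) < toℕ i)

Contains312 : ∀ {m} → Permutation′ m → Set
Contains312 {m} σ =
  Σ (Fin m) λ i → Σ (Fin m) λ j → Σ (Fin m) λ k →
    (toℕ i < toℕ j) × (toℕ j < toℕ k) ×
    (toℕ (σ ⟨$⟩ʳ j) < toℕ (σ ⟨$⟩ʳ k)) × (toℕ (σ ⟨$⟩ʳ k) < toℕ (σ ⟨$⟩ʳ i))

Avoids312 : ∀ {m} → Permutation′ m → Set
Avoids312 σ = ¬ Contains312 σ

InD2-312 : (n : ℕ) → Permutation′ (2 * n) → Set
InD2-312 n π = IsDumont2 n π × Avoids312 π

{-# OPTIONS --safe #-}
-- The permutation π = 2 1 4 3 ⋯ 2n (2n−1), which swaps the entries of each pair of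
-- positions (2k−1, 2k), is Dumont of the second kind, and it avoids 312 because it moves
-- every entry by at most one. Conversely, let σ be a 312-avoiding Dumont permutation of the
-- second kind agreeing with π on the first 2k positions, so that the values 1, …, 2k are
-- used up there. The deficiency σ(2k+2) is then 2k+1, so the excedance σ(2k+1) is at least
-- 2k+2; were it larger, the value 2k+2 would sit at a position r > 2k+2, and the positions
-- 2k+1 < 2k+2 < r would carry a 312.

module Submission where

open import Defs
open import Data.Nat using (ℕ; zero; suc; _*_; _+_; _<_; _≤_; z≤n; s≤s)
open import Data.Nat.Properties
  using (suc-injective; +-comm; +-suc; *-suc; ≤-refl; ≤-trans; ≤-antisym; ≤-pred; n≤1+n;
         <-irrefl; <⇒≱; ≮⇒≥; ≤∧≢⇒<; m<1+n⇒m<n∨m≡n; 1+n≢n)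
open import Data.Fin using (Fin; toℕ; fromℕ<)
open import Data.Fin.Properties using (toℕ-injective; toℕ-fromℕ<; toℕ<n)
open import Data.Fin.Permutation
  using (Permutation′; _≈_; permutation; _⟨$⟩ʳ_; _⟨$⟩ˡ_; inverseˡ; inverseʳ)
open import Data.Product using (Σ; ∃-syntax; _×_; _,_; proj₁; proj₂)
open import Data.Sum using (_⊎_; inj₁; inj₂)
open import Function using (_∘_)
open import Relation.Nullary using (¬_; contradiction)
open import Relation.Binary.PropositionalEquality

pairSwap : ℕ → ℕ
pairSwap zero          = 1
pairSwap (suc zero)    = 0
pairSwap (suc (suc x)) = suc (suc (pairSwap x))

pairSwap-involutive : ∀ x → pairSwap (pairSwap x) ≡ x
pairSwap-involutive zero          = refl
pairSwap-involutive (suc zero)    = refl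
pairSwap-involutive (suc (suc x)) = cong (suc ∘ suc) (pairSwap-involutive x)

pairSwap-double : ∀ k → pairSwap (2 * k) ≡ suc (2 * k)
pairSwap-double zero = refl
pairSwap-double (suc k) rewrite *-suc 2 k = cong (suc ∘ suc) (pairSwap-double k)

pairSwap-suc-double : ∀ k → pairSwap (suc (2 * k)) ≡ 2 * k
pairSwap-suc-double k =
  trans (cong pairSwap (sym (pairSwap-double k))) (pairSwap-involutive (2 * k))

pairSwap-<-double : ∀ k x → x < 2 * k → pairSwap x < 2 * k
pairSwap-<-double zero x ()
pairSwap-<-double (suc k) x x<2k+2 rewrite *-suc 2 k = pairSwap-<-2+ x x<2k+2
  where
  pairSwap-<-2+ : ∀ x → x < 2 + 2 * k → pairSwap x < 2 + 2 * k
  pairSwap-<-2+ zero          _                  = s≤s (s≤s z≤n)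
  pairSwap-<-2+ (suc zero)    _                  = s≤s z≤n
  pairSwap-<-2+ (suc (suc x)) (s≤s (s≤s x<2k)) = s≤s (s≤s (pairSwap-<-double k x x<2k))

pairSwap≤1+n : ∀ x → pairSwap x ≤ suc x
pairSwap≤1+n zero          = ≤-refl
pairSwap≤1+n (suc zero)    = z≤n
pairSwap≤1+n (suc (suc x)) = s≤s (s≤s (pairSwap≤1+n x))

n≤1+pairSwap : ∀ x → x ≤ suc (pairSwap x)
n≤1+pairSwap zero          = z≤n
n≤1+pairSwap (suc zero)    = ≤-refl
n≤1+pairSwap (suc (suc x)) = s≤s (s≤s (n≤1+pairSwap x))

even⊎odd : ∀ x → (∃[ k ] x ≡ 2 * k) ⊎ (∃[ k ] x ≡ suc (2 * k))
even⊎odd zero = inj₁ (0 , refl)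
even⊎odd (suc x) with even⊎odd x
... | inj₁ (k , x≡2k)   = inj₂ (k , cong suc x≡2k)
... | inj₂ (k , x≡2k+1) = inj₁ (suc k , trans (cong suc x≡2k+1) (sym (*-suc 2 k)))

Even-inv : ∀ {m} → Even m → m ≡ 0 ⊎ ∃[ n ] (m ≡ suc (suc n) × Even n)
Even-inv even-zero        = inj₁ refl
Even-inv (even-ss {n} e) = inj₂ (n , +-comm n 2 , e)

Even-double : ∀ k → Even (2 * k)
Even-double zero    = even-zero
Even-double (suc k) =
  subst Even (trans (+-comm (2 * k) 2) (sym (*-suc 2 k))) (even-ss (Even-double k))

Even-suc-double+1 : ∀ k → Even (suc (2 * k) + 1)
Even-suc-double+1 k = subst Even (+-suc (2 * k) 1) (even-ss (Even-double k))

¬Even-double+1 : ∀ k → ¬ Even (2 * k + 1)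
¬Even-double+1 k e with Even-inv e
¬Even-double+1 zero    e | inj₁ ()
¬Even-double+1 zero    e | inj₂ (_ , () , _)
¬Even-double+1 (suc k) e | inj₁ ()
¬Even-double+1 (suc k) e | inj₂ (n , 2k+3≡n+2 , even-n) =
  ¬Even-double+1 k (subst Even (sym 2k+1≡n) even-n)
  where
  2k+1≡n : 2 * k + 1 ≡ n
  2k+1≡n = suc-injective (suc-injective (trans (sym (cong (_+ 1) (*-suc 2 k))) 2k+3≡n+2))

pairSwap-dumont : ∀ x → (¬ Even (x + 1) → x ≤ pairSwap x) × (Even (x + 1) → pairSwap x < x)
pairSwap-dumont x with even⊎odd x
... | inj₁ (k , refl) =
  (λ _ → subst (2 * k ≤_) (sym (pairSwap-double k)) (n≤1+n (2 * k))) ,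
  (λ even → contradiction even (¬Even-double+1 k))
... | inj₂ (k , refl) =
  (λ ¬even → contradiction (Even-suc-double+1 k) ¬even) ,
  (λ _ → subst (_< suc (2 * k)) (sym (pairSwap-suc-double k)) ≤-refl)

module _ (n : ℕ) where

  pairSwapFin : Fin (2 * n) → Fin (2 * n)
  pairSwapFin i = fromℕ< (pairSwap-<-double n (toℕ i) (toℕ<n i))

  toℕ-pairSwapFin : ∀ i → toℕ (pairSwapFin i) ≡ pairSwap (toℕ i)
  toℕ-pairSwapFin i = toℕ-fromℕ< (pairSwap-<-double n (toℕ i) (toℕ<n i))

  pairSwapFin-involutive : ∀ i → pairSwapFin (pairSwapFin i) ≡ i
  pairSwapFin-involutive i = toℕ-injective (begin
    toℕ (pairSwapFin (pairSwapFin i)) ≡⟨ toℕ-pairSwapFin (pairSwapFin i) ⟩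
    pairSwap (toℕ (pairSwapFin i))    ≡⟨ cong pairSwap (toℕ-pairSwapFin i) ⟩
    pairSwap (pairSwap (toℕ i))       ≡⟨ pairSwap-involutive (toℕ i) ⟩
    toℕ i                             ∎)
    where open ≡-Reasoning

  pairSwapPerm : Permutation′ (2 * n)
  pairSwapPerm = permutation pairSwapFin pairSwapFin pairSwapFin-involutive pairSwapFin-involutive

  pairSwapPerm-isDumont2 : IsDumont2 n pairSwapPerm
  pairSwapPerm-isDumont2 i rewrite toℕ-pairSwapFin i = pairSwap-dumont (toℕ i)

  -- pairSwap moves every entry by at most one, so π(k) < π(i) forces k ≤ i + 1,
  -- leaving no room for a position strictly between i and k.
  pairSwapPerm-avoids312 : Avoids312 pairSwapPerm
  pairSwapPerm-avoids312 (i , j , k , i<j , j<k , _ , πk<πi) =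
    <⇒≱ (≤-trans (s≤s i<j) j<k) k≤1+i
    where
    k≤1+i : toℕ k ≤ suc (toℕ i)
    k≤1+i = ≤-trans (n≤1+pairSwap (toℕ k))
              (≤-trans (subst₂ (λ a b → suc a ≤ b) (toℕ-pairSwapFin k) (toℕ-pairSwapFin i) πk<πi)
                       (pairSwap≤1+n (toℕ i)))

module Uniqueness (n : ℕ) (σ : Permutation′ (2 * n)) where

  value : Fin (2 * n) → ℕ
  value i = toℕ (σ ⟨$⟩ʳ i)

  value-injective : ∀ {i j} → value i ≡ value j → i ≡ j
  value-injective {i} {j} eq = begin
    i                     ≡⟨ inverseˡ σ ⟨
    σ ⟨$⟩ˡ (σ ⟨$⟩ʳ i)     ≡⟨ cong (σ ⟨$⟩ˡ_) (toℕ-injective eq) ⟩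
    σ ⟨$⟩ˡ (σ ⟨$⟩ʳ j)     ≡⟨ inverseˡ σ ⟩
    j                     ∎
    where open ≡-Reasoning

  AgreesBelow : ℕ → Set
  AgreesBelow b = ∀ i → toℕ i < b → value i ≡ pairSwap (toℕ i)

  module _ {k : ℕ} (agrees : AgreesBelow (2 * k)) where

    agreesBelow-value< : ∀ i → toℕ i < 2 * k → value i < 2 * k
    agreesBelow-value< i i<2k =
      subst (_< 2 * k) (sym (agrees i i<2k)) (pairSwap-<-double k (toℕ i) i<2k)

    -- The entry v < 2k is found at position pairSwap v, which is below 2k.
    agreesBelow-position< : ∀ i → value i < 2 * k → toℕ i < 2 * k
    agreesBelow-position< i v<2k = subst (_< 2 * k) (cong toℕ j≡i) j<2k
      where
      j = pairSwapPerm n ⟨$⟩ʳ (σ ⟨$⟩ʳ i)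
      j<2k : toℕ j < 2 * k
      j<2k = subst (_< 2 * k) (sym (toℕ-pairSwapFin n _)) (pairSwap-<-double k (value i) v<2k)
      j≡i : j ≡ i
      j≡i = value-injective (begin
        value j                       ≡⟨ agrees j j<2k ⟩
        pairSwap (toℕ j)              ≡⟨ cong pairSwap (toℕ-pairSwapFin n _) ⟩
        pairSwap (pairSwap (value i)) ≡⟨ pairSwap-involutive (value i) ⟩
        value i                       ∎)
        where open ≡-Reasoning

    agreesBelow-position≥ : ∀ i → 2 * k ≤ value i → 2 * k ≤ toℕ i
    agreesBelow-position≥ i 2k≤vi = ≮⇒≥ λ i<2k → <⇒≱ (agreesBelow-value< i i<2k) 2k≤vi

    agreesBelow-value≥ : ∀ i → 2 * k ≤ toℕ i → 2 * k ≤ value i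
    agreesBelow-value≥ i 2k≤i = ≮⇒≥ λ vi<2k → <⇒≱ (agreesBelow-position< i vi<2k) 2k≤i

  module _ (dumont : IsDumont2 n σ) (avoids : Avoids312 σ) where

    module _ {k : ℕ} (agrees : AgreesBelow (2 * k)) where

      value-at-odd : ∀ j → toℕ j ≡ suc (2 * k) → value j ≡ 2 * k
      value-at-odd j tj = ≤-antisym (≤-pred vj<2k+1) 2k≤vj
        where
        vj<2k+1 : value j < suc (2 * k)
        vj<2k+1 = subst (value j <_) tj
          (proj₂ (dumont j) (subst (λ x → Even (x + 1)) (sym tj) (Even-suc-double+1 k)))
        2k≤vj : 2 * k ≤ value j
        2k≤vj = agreesBelow-value≥ {k} agrees j (subst (2 * k ≤_) (sym tj) (n≤1+n (2 * k)))

      value-at-even≤ : ∀ i j → toℕ i ≡ 2 * k → toℕ j ≡ suc (2 * k) → value i ≤ suc (2 * k)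
      value-at-even≤ i j ti tj = ≮⇒≥ 312-at-i-j
        where
        -- Otherwise the entry 2k+1 sits at a position r after j, and (i, j, r) carries a 312.
        312-at-i-j : ¬ suc (2 * k) < value i
        312-at-i-j 2k+1<vi = avoids (i , j , r , i<j , j<r , vj<vr , vr<vi)
          where
          r = σ ⟨$⟩ˡ j
          vr≡2k+1 : value r ≡ suc (2 * k)
          vr≡2k+1 = trans (cong toℕ (inverseʳ σ)) tj
          vj≡2k : value j ≡ 2 * k
          vj≡2k = value-at-odd j tj
          2k≤r : 2 * k ≤ toℕ r
          2k≤r = agreesBelow-position≥ {k} agrees r (subst (2 * k ≤_) (sym vr≡2k+1) (n≤1+n (2 * k)))
          2k≢r : 2 * k ≢ toℕ r
          2k≢r 2k≡r = <-irrefl (trans (sym vr≡2k+1) (cong value r≡i)) 2k+1<vi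
            where
            r≡i : r ≡ i
            r≡i = toℕ-injective (trans (sym 2k≡r) (sym ti))
          2k+1≢r : suc (2 * k) ≢ toℕ r
          2k+1≢r 2k+1≡r = 1+n≢n (trans (sym vr≡2k+1) (trans (cong value r≡j) vj≡2k))
            where
            r≡j : r ≡ j
            r≡j = toℕ-injective (trans (sym 2k+1≡r) (sym tj))
          i<j : toℕ i < toℕ j
          i<j = subst₂ _<_ (sym ti) (sym tj) ≤-refl
          j<r : toℕ j < toℕ r
          j<r = subst (_< toℕ r) (sym tj) (≤∧≢⇒< (≤∧≢⇒< 2k≤r 2k≢r) 2k+1≢r)
          vj<vr : value j < value r
          vj<vr = subst₂ _<_ (sym vj≡2k) (sym vr≡2k+1) ≤-refl
          vr<vi : value r < value i
          vr<vi = subst (_< value i) (sym vr≡2k+1) 2k+1<vi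

      value-at-even : ∀ i j → toℕ i ≡ 2 * k → toℕ j ≡ suc (2 * k) → value i ≡ suc (2 * k)
      value-at-even i j ti tj = ≤-antisym (value-at-even≤ i j ti tj) (≤∧≢⇒< 2k≤vi 2k≢vi)
        where
        2k≤vi : 2 * k ≤ value i
        2k≤vi = subst (_≤ value i) ti
          (proj₁ (dumont i) (subst (λ x → ¬ Even (x + 1)) (sym ti) (¬Even-double+1 k)))
        2k≢vi : 2 * k ≢ value i
        2k≢vi 2k≡vi = 1+n≢n (begin
          suc (2 * k) ≡⟨ tj ⟨
          toℕ j       ≡⟨ cong toℕ (value-injective (trans (value-at-odd j tj) 2k≡vi)) ⟩
          toℕ i       ≡⟨ ti ⟩
          2 * k       ∎)
          where open ≡-Reasoning

      agreesBelow-step : AgreesBelow (2 * suc k)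
      agreesBelow-step i i<2k+2 with m<1+n⇒m<n∨m≡n (subst (toℕ i <_) (*-suc 2 k) i<2k+2)
      ... | inj₂ ti =
        trans (value-at-odd i ti) (sym (trans (cong pairSwap ti) (pairSwap-suc-double k)))
      ... | inj₁ i<2k+1 with m<1+n⇒m<n∨m≡n i<2k+1
      ...   | inj₁ i<2k = agrees i i<2k
      ...   | inj₂ ti = trans (value-at-even i (pairSwapPerm n ⟨$⟩ʳ i) ti tj) (sym swap-i)
        where
        swap-i : pairSwap (toℕ i) ≡ suc (2 * k)
        swap-i = trans (cong pairSwap ti) (pairSwap-double k)
        tj : toℕ (pairSwapPerm n ⟨$⟩ʳ i) ≡ suc (2 * k)
        tj = trans (toℕ-pairSwapFin n i) swap-i

    agreesBelow : ∀ k → AgreesBelow (2 * k)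
    agreesBelow zero    i ()
    agreesBelow (suc k) = agreesBelow-step {k} (agreesBelow k)

    ≈-pairSwapPerm : σ ≈ pairSwapPerm n
    ≈-pairSwapPerm i = toℕ-injective (trans (agreesBelow n i (toℕ<n i)) (sym (toℕ-pairSwapFin n i)))

theorem2p5 : (n : ℕ) →
    Σ (Permutation′ (2 * n)) λ π → InD2-312 n π ×
      ((σ : Permutation′ (2 * n)) → InD2-312 n σ → σ ≈ π)
theorem2p5 n =
  pairSwapPerm n ,
  (pairSwapPerm-isDumont2 n , pairSwapPerm-avoids312 n) ,
  λ σ (dumont , avoids) → Uniqueness.≈-pairSwapPerm n σ dumont avoids
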